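{- None of $C_4$, the diamond, and the claw is a biclique line graph; that is, there is no finite simple graph $G$ such that $L_G$ is isomorphic to $C_4$, to the diamond, or to the claw.
   Context: A biclique of $G$ is a vertex set $B\subseteq V(G)$ such that $G[B]$ is a complete bipartite graph and $B$ is inclusion-wise maximal with this property. The biclique line graph $L_G$ has vertex set $E(G)$, two edges of $G$ being adjacent iff they are both edges of $G[B]$ for some biclique $B$ of $G$. $C_4$ is the cycle on four vertices, the diamond is $K_4$ minus one edge, and the claw is $K_{1,3}$. -}

module Defs where

open import Data.Bool using (Bool; true; false)
open import Data.Nat using (ℕ)
open import Data.Fin using (Fin; zero; suc; _<_)
open import Data.Fin.Subset using (Subset; _∈_; _⊆_)
open import Data.Product using (Σ; ∃; _×_; _,_)
open import Data.Sum using (_⊎_)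
open import Function.Bundles using (_↔_; _⇔_; Inverse)
open import Relation.Binary.PropositionalEquality using (_≡_; _≢_)
open import Relation.Nullary using (¬_)

record Graph : Set where
  field
    n      : ℕ
    adj    : Fin n → Fin n → Bool
    sym    : ∀ u v → adj u v ≡ adj v u
    irrefl : ∀ v → adj v v ≡ false

open Graph public

-- E(G): an edge {u,v} is represented once, by its endpoints with u < v.
Edge : Graph → Set
Edge G = Σ (Fin (n G)) λ u → Σ (Fin (n G)) λ v → (u < v) × (adj G u v ≡ true)

-- G[B] is complete bipartite: there is a 2-colouring of B such that two
-- vertices of B are adjacent iff they receive different colours.
-- (Degenerate cases with an empty side are allowed; they contain no edges
-- and so do not affect L_G.)
IsCompleteBipartite : (G : Graph) → Subset (n G) → Set
IsCompleteBipartite G B =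
  Σ (Fin (n G) → Bool) λ c →
    ∀ u v → u ∈ B → v ∈ B → (adj G u v ≡ true ⇔ c u ≢ c v)

IsBiclique : (G : Graph) → Subset (n G) → Set
IsBiclique G B =
  IsCompleteBipartite G B ×
  (∀ B' → B ⊆ B' → IsCompleteBipartite G B' → B' ⊆ B)

EdgeIn : (G : Graph) → Edge G → Subset (n G) → Set
EdgeIn G (u , v , _) B = (u ∈ B) × (v ∈ B)

LAdj : (G : Graph) → Edge G → Edge G → Set
LAdj G e f = (e ≢ f) × ∃ λ B → IsBiclique G B × EdgeIn G e B × EdgeIn G f B

LineGraphIso : (G : Graph) (k : ℕ) (H : Fin k → Fin k → Bool) → Set
LineGraphIso G k H =
  Σ (Edge G ↔ Fin k) λ φ →
    ∀ e f → (LAdj G e f ⇔ H (Inverse.to φ e) (Inverse.to φ f) ≡ true)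

-- The three target graphs on vertices 0,1,2,3.
-- C4: 0-1-2-3-0
c4 : Fin 4 → Fin 4 → Bool
c4 zero (suc zero) = true
c4 (suc zero) zero = true
c4 (suc zero) (suc (suc zero)) = true
c4 (suc (suc zero)) (suc zero) = true
c4 (suc (suc zero)) (suc (suc (suc zero))) = true
c4 (suc (suc (suc zero))) (suc (suc zero)) = true
c4 (suc (suc (suc zero))) zero = true
c4 zero (suc (suc (suc zero))) = true
c4 _ _ = false

-- diamond: K4 minus the edge {2,3}
diamond : Fin 4 → Fin 4 → Bool
diamond zero zero = false
diamond (suc zero) (suc zero) = false
diamond (suc (suc zero)) (suc (suc zero)) = false
diamond (suc (suc (suc zero))) (suc (suc (suc zero))) = false
diamond (suc (suc zero)) (suc (suc (suc zero))) = false
diamond (suc (suc (suc zero))) (suc (suc zero)) = false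
diamond _ _ = true

-- claw K_{1,3}: centre 0, leaves 1,2,3
claw : Fin 4 → Fin 4 → Bool
claw zero zero = false
claw zero _ = true
claw _ zero = true
claw _ _ = false

module Submission where

-- Two edges of G are adjacent in L_G iff their ends induce a complete bipartite graph, since such
-- a set extends greedily to a biclique.  Hence edges xv, xw at a common vertex are adjacent iff vw
-- is not an edge, and disjoint edges pq, rs are adjacent iff they lie on an induced 4-cycle
-- p–q–s–r, in which case pq, rs, pr, qs form a K₄ of L_G.  As C₄, the diamond and the claw are
-- K₄-free, adjacent edges must meet; as C₄ and the diamond have no independent triple, distinct
-- non-adjacent edges xv, xw cannot meet (vw would complete an independent triple).  So the four
-- edges realising C₄ form an induced 4-cycle of G, whose opposite edges are adjacent after all;
-- the two central edges of a diamond meet at a vertex and end on one edge, i.e. span a triangle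
-- or coincide; and two leaves of a claw meet the central edge e at a common end x, so their other
-- ends v, w are adjacent, and as every edge meets e, the edge vw forces one of the leaves to be e.

open import Defs hiding (sym)

open import Axiom.UniquenessOfIdentityProofs using (module Decidable⇒UIP)
open import Data.Bool using (Bool; true; false; _xor_)
open import Data.Bool.Properties using (xor-same; xor-comm; xor-assoc; not-¬; ¬-not) renaming (_≟_ to _≟ᴮ_)
open import Data.Empty using (⊥; ⊥-elim)
open import Data.Fin using (Fin; zero; suc; #_) renaming (_<_ to _<ᶠ_)
open import Data.Fin.Properties using (any?; all?; <-cmp; <-irrelevant; <⇒≢; <-asym) renaming (_≟_ to _≟ᶠ_)
open import Data.Fin.Subset using (Subset; _∈_; _∉_; _⊆_; _∪_; ⁅_⁆)
open import Data.Fin.Subset.Properties using (_∈?_; x∈⁅x⁆; x∈⁅y⁆⇒x≡y; p⊆p∪q; q⊆p∪q; x∈p∪q⁻)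
open import Data.List using (List; []; _∷_; allFin)
open import Data.List.Membership.Propositional using () renaming (_∈_ to _∈ˡ_)
open import Data.List.Membership.Propositional.Properties using (∈-allFin)
open import Data.List.Relation.Unary.Any using (here; there)
open import Data.Product using (_×_; ∃; ∃₂; ∃-syntax; _,_; proj₁; proj₂)
open import Data.Sum using (_⊎_; inj₁; inj₂; [_,_])
import Data.Sum as Sum
open import Function.Base using (_∘_; id)
open import Function.Bundles using (_⇔_; _↔_; Inverse; Injection; mk⇔; Equivalence)
open import Function.Properties.Inverse using (↔-sym; ↔⇒↣)
open import Relation.Binary.Definitions using (tri<; tri≈; tri>)
open import Relation.Binary.PropositionalEquality
  using (_≡_; _≢_; refl; sym; trans; cong; cong₂; subst; ≢-sym)
open import Relation.Nullary using (¬_; Dec; yes; no)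
open import Relation.Nullary.Decidable using (_×-dec_; _→-dec_; ¬?; from-yes; map′)

≡xor⇒⇔≢ : ∀ a x y → a ≡ x xor y → (a ≡ true ⇔ x ≢ y)
≡xor⇒⇔≢ _ true  true  refl = mk⇔ (λ ()) (λ x≢x → ⊥-elim (x≢x refl))
≡xor⇒⇔≢ _ true  false refl = mk⇔ (λ _ ()) (λ _ → refl)
≡xor⇒⇔≢ _ false true  refl = mk⇔ (λ _ ()) (λ _ → refl)
≡xor⇒⇔≢ _ false false refl = mk⇔ (λ ()) (λ x≢x → ⊥-elim (x≢x refl))

⇔≢⇒≡xor : ∀ a x y → (a ≡ true ⇔ x ≢ y) → a ≡ x xor y
⇔≢⇒≡xor true  true  true  a⇔ = ⊥-elim (Equivalence.to a⇔ refl refl)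
⇔≢⇒≡xor true  true  false a⇔ = refl
⇔≢⇒≡xor true  false true  a⇔ = refl
⇔≢⇒≡xor true  false false a⇔ = ⊥-elim (Equivalence.to a⇔ refl refl)
⇔≢⇒≡xor false true  true  a⇔ = refl
⇔≢⇒≡xor false true  false a⇔ with () ← Equivalence.from a⇔ (λ ())
⇔≢⇒≡xor false false true  a⇔ with () ← Equivalence.from a⇔ (λ ())
⇔≢⇒≡xor false false false a⇔ = refl

xor-interchange : ∀ a b c d → a xor b ≡ c xor d → a xor c ≡ b xor d
xor-interchange true  true  true  true  _  = refl
xor-interchange true  true  true  false ()
xor-interchange true  true  false true  ()
xor-interchange true  true  false false _  = refl
xor-interchange true  false true  true  ()
xor-interchange true  false true  false _  = refl
xor-interchange true  false false true  _  = refl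
xor-interchange true  false false false ()
xor-interchange false true  true  true  ()
xor-interchange false true  true  false _  = refl
xor-interchange false true  false true  _  = refl
xor-interchange false true  false false ()
xor-interchange false false true  true  _  = refl
xor-interchange false false true  false ()
xor-interchange false false false true  ()
xor-interchange false false false false _  = refl

xor-triangle : ∀ a b c → a xor b ≡ true → a xor c ≡ true → b xor c ≡ true → ⊥
xor-triangle true  true  _     ()
xor-triangle true  false true  _ ()
xor-triangle true  false false _ _ ()
xor-triangle false true  true  _ _ ()
xor-triangle false true  false _ ()
xor-triangle false false _     ()

Matched : {X : Set} → (X → X → Bool) → X → X → X → X → Set
Matched R p q r s = R p r ≡ true × R q s ≡ true × R p s ≡ false × R q r ≡ false

xor-matched : ∀ a b c d → a xor b ≡ true → c xor d ≡ true →
  Matched _xor_ a b c d ⊎ Matched _xor_ a b d c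
xor-matched true  true  _     _     ()
xor-matched false false _     _     ()
xor-matched _     _     true  true  _ ()
xor-matched _     _     false false _ ()
xor-matched true  false true  false _ _ = inj₂ (refl , refl , refl , refl)
xor-matched true  false false true  _ _ = inj₁ (refl , refl , refl , refl)
xor-matched false true  true  false _ _ = inj₁ (refl , refl , refl , refl)
xor-matched false true  false true  _ _ = inj₂ (refl , refl , refl , refl)

module BicliqueLineGraph (G : Graph) where
  V : Set
  V = Fin (n G)

  A : V → V → Bool
  A = adj G

  E : Set
  E = Edge G

  adjacent⇒≢ : ∀ {x y} → A x y ≡ true → x ≢ y
  adjacent⇒≢ {x} x~y refl with () ← trans (sym x~y) (irrefl G x)

  data _∈ₑ_ : V → E → Set where
    lo : ∀ {u v u<v u~v} → u ∈ₑ (u , v , u<v , u~v)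
    hi : ∀ {u v u<v u~v} → v ∈ₑ (u , v , u<v , u~v)

  Joins : E → V → V → Set
  Joins e x y = x ∈ₑ e × y ∈ₑ e × x ≢ y

  Meet : E → E → Set
  Meet e f = ∃[ x ] x ∈ₑ e × x ∈ₑ f

  joins-ends : ∀ {u v} (u<v : u <ᶠ v) (u~v : A u v ≡ true) → Joins (u , v , u<v , u~v) u v
  joins-ends u<v _ = lo , hi , <⇒≢ u<v

  end₁ : ∀ {e x y} → Joins e x y → x ∈ₑ e
  end₁ = proj₁

  end₂ : ∀ {e x y} → Joins e x y → y ∈ₑ e
  end₂ = proj₁ ∘ proj₂

  ends-distinct : ∀ {e x y} → Joins e x y → x ≢ y
  ends-distinct = proj₂ ∘ proj₂

  joins-sym : ∀ {e x y} → Joins e x y → Joins e y x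
  joins-sym (x∈e , y∈e , x≢y) = y∈e , x∈e , ≢-sym x≢y

  joins⇒adjacent : ∀ {e x y} → Joins e x y → A x y ≡ true
  joins⇒adjacent {_ , _ , _ , u~v} (lo , hi , _) = u~v
  joins⇒adjacent {u , v , _ , u~v} (hi , lo , _) = trans (Graph.sym G v u) u~v
  joins⇒adjacent (lo , lo , x≢x) = ⊥-elim (x≢x refl)
  joins⇒adjacent (hi , hi , x≢x) = ⊥-elim (x≢x refl)

  joins-∈ₑ : ∀ {e x y z} → Joins e x y → z ∈ₑ e → z ≡ x ⊎ z ≡ y
  joins-∈ₑ (lo , hi , _) lo = inj₁ refl
  joins-∈ₑ (lo , hi , _) hi = inj₂ refl
  joins-∈ₑ (hi , lo , _) lo = inj₂ refl
  joins-∈ₑ (hi , lo , _) hi = inj₁ refl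
  joins-∈ₑ (lo , lo , x≢x) _ = ⊥-elim (x≢x refl)
  joins-∈ₑ (hi , hi , x≢x) _ = ⊥-elim (x≢x refl)

  other-end : ∀ {e x} → x ∈ₑ e → ∃[ y ] Joins e x y
  other-end {_ , _ , u<v , u~v} lo = _ , joins-ends u<v u~v
  other-end {_ , _ , u<v , u~v} hi = _ , joins-sym (joins-ends u<v u~v)

  edge-joining : ∀ {x y} → A x y ≡ true → ∃[ e ] Joins e x y
  edge-joining {x} {y} x~y with <-cmp x y
  ... | tri< x<y _ _ = _ , joins-ends x<y x~y
  ... | tri≈ _ refl _ = ⊥-elim (adjacent⇒≢ x~y refl)
  ... | tri> _ _ y<x = _ , joins-sym (joins-ends y<x (trans (Graph.sym G y x) x~y))

  edge-ext : ∀ {u v u' v'} (u<v : u <ᶠ v) (u~v : A u v ≡ true) (u'<v' : u' <ᶠ v') (u'~v' : A u' v' ≡ true) →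
    u ≡ u' → v ≡ v' → _≡_ {A = E} (u , v , u<v , u~v) (u' , v' , u'<v' , u'~v')
  edge-ext u<v u~v u'<v' u'~v' refl refl
    rewrite <-irrelevant u<v u'<v' | Decidable⇒UIP.≡-irrelevant _≟ᴮ_ u~v u'~v' = refl

  joins-injective : ∀ {e f x y} → Joins e x y → Joins f x y → e ≡ f
  joins-injective {_ , _ , u<v , u~v} {_ , _ , u'<v' , u'~v'} (lo , hi , _) (lo , hi , _) =
    edge-ext u<v u~v u'<v' u'~v' refl refl
  joins-injective {_ , _ , u<v , u~v} {_ , _ , u'<v' , u'~v'} (hi , lo , _) (hi , lo , _) =
    edge-ext u<v u~v u'<v' u'~v' refl refl
  joins-injective {_ , _ , u<v , _} {_ , _ , v<u , _} (lo , hi , _) (hi , lo , _) = ⊥-elim (<-asym u<v v<u)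
  joins-injective {_ , _ , u<v , _} {_ , _ , v<u , _} (hi , lo , _) (lo , hi , _) = ⊥-elim (<-asym u<v v<u)
  joins-injective (lo , lo , x≢x) _ = ⊥-elim (x≢x refl)
  joins-injective (hi , hi , x≢x) _ = ⊥-elim (x≢x refl)
  joins-injective (lo , hi , _) (lo , lo , x≢x) = ⊥-elim (x≢x refl)
  joins-injective (lo , hi , _) (hi , hi , x≢x) = ⊥-elim (x≢x refl)
  joins-injective (hi , lo , _) (lo , lo , x≢x) = ⊥-elim (x≢x refl)
  joins-injective (hi , lo , _) (hi , hi , x≢x) = ⊥-elim (x≢x refl)

  meet-refl : ∀ e → Meet e e
  meet-refl (u , _) = u , lo , lo

  ∉-ends⇒≢ : ∀ {e k x y z} → Joins e x y → z ∈ₑ k → z ≢ x → z ≢ y → e ≢ k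
  ∉-ends⇒≢ x—y z∈k z≢x z≢y refl with joins-∈ₑ x—y z∈k
  ... | inj₁ z≡x = z≢x z≡x
  ... | inj₂ z≡y = z≢y z≡y

  apart⇒≢ : ∀ {e f x y} → ¬ Meet e f → x ∈ₑ e → y ∈ₑ f → x ≢ y
  apart⇒≢ apart x∈e y∈f refl = apart (_ , x∈e , y∈f)

  meet? : ∀ e f → Dec (Meet e f)
  meet? e f = any? λ x → (x ∈ₑ? e) ×-dec (x ∈ₑ? f)
    where
    _∈ₑ?_ : ∀ x e → Dec (x ∈ₑ e)
    x ∈ₑ? (u , v , _) with x ≟ᶠ u | x ≟ᶠ v
    ... | yes refl | _        = yes lo
    ... | no _     | yes refl = yes hi
    ... | no x≢u   | no x≢v   = no λ { lo → x≢u refl ; hi → x≢v refl }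

  -- Complete bipartite sets and bicliques

  record Bipartition (B : Subset (n G)) (c : V → Bool) : Set where
    constructor bipartition
    field adj≡xor : ∀ {u v} → u ∈ B → v ∈ B → A u v ≡ c u xor c v
  open Bipartition public

  CompleteBipartite : Subset (n G) → Set
  CompleteBipartite B = ∃ (Bipartition B)

  CompleteBipartite⇒IsCompleteBipartite : ∀ {B} → CompleteBipartite B → IsCompleteBipartite G B
  CompleteBipartite⇒IsCompleteBipartite (c , split) =
    c , λ u v u∈B v∈B → ≡xor⇒⇔≢ _ (c u) (c v) (adj≡xor split u∈B v∈B)

  IsCompleteBipartite⇒CompleteBipartite : ∀ {B} → IsCompleteBipartite G B → CompleteBipartite B
  IsCompleteBipartite⇒CompleteBipartite (c , split) =
    c , bipartition λ {u} {v} u∈B v∈B → ⇔≢⇒≡xor _ (c u) (c v) (split u v u∈B v∈B)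

  CompleteBipartite-⊆ : ∀ {B B' : Subset (n G)} → B ⊆ B' → CompleteBipartite B' → CompleteBipartite B
  CompleteBipartite-⊆ B⊆B' (c , split) =
    c , bipartition λ u∈B v∈B → adj≡xor split (B⊆B' u∈B) (B⊆B' v∈B)

  Bipartition-adjacent : ∀ {B c u v} → Bipartition B c → u ∈ B → v ∈ B → A u v ≡ true → c u xor c v ≡ true
  Bipartition-adjacent split u∈B v∈B u~v = trans (sym (adj≡xor split u∈B v∈B)) u~v

  Bipartition-triangle : ∀ {B c x v w} → Bipartition B c → x ∈ B → v ∈ B → w ∈ B →
    A x v ≡ true → A x w ≡ true → A v w ≡ true → ⊥
  Bipartition-triangle {c = c} {x} {v} {w} split x∈B v∈B w∈B x~v x~w v~w = xor-triangle (c x) (c v) (c w)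
    (Bipartition-adjacent split x∈B v∈B x~v) (Bipartition-adjacent split x∈B w∈B x~w)
    (Bipartition-adjacent split v∈B w∈B v~w)

  Bipartition-Matched : ∀ {B c p q r s} → Bipartition B c → p ∈ B → q ∈ B → r ∈ B → s ∈ B →
    Matched _xor_ (c p) (c q) (c r) (c s) → Matched A p q r s
  Bipartition-Matched split p∈B q∈B r∈B s∈B (p~r , q~s , p≁s , q≁r) =
    trans (adj≡xor split p∈B r∈B) p~r , trans (adj≡xor split q∈B s∈B) q~s ,
    trans (adj≡xor split p∈B s∈B) p≁s , trans (adj≡xor split q∈B r∈B) q≁r

  Bipartition-matched : ∀ {B c p q r s} → Bipartition B c → p ∈ B → q ∈ B → r ∈ B → s ∈ B →
    A p q ≡ true → A r s ≡ true → Matched A p q r s ⊎ Matched A p q s r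
  Bipartition-matched {c = c} {p} {q} {r} {s} split p∈B q∈B r∈B s∈B p~q r~s =
    Sum.map (Bipartition-Matched split p∈B q∈B r∈B s∈B) (Bipartition-Matched split p∈B q∈B s∈B r∈B)
      (xor-matched (c p) (c q) (c r) (c s)
        (Bipartition-adjacent split p∈B q∈B p~q) (Bipartition-adjacent split r∈B s∈B r~s))

  ∈-insert⁻ : ∀ w (B : Subset (n G)) {u} → u ∈ ⁅ w ⁆ ∪ B → u ≡ w ⊎ u ∈ B
  ∈-insert⁻ w B u∈ with x∈p∪q⁻ ⁅ w ⁆ B u∈
  ... | inj₁ u∈⁅w⁆ = inj₁ (x∈⁅y⁆⇒x≡y w u∈⁅w⁆)
  ... | inj₂ u∈B   = inj₂ u∈B

  ∈-insert⁺ˡ : ∀ {w} {B : Subset (n G)} → w ∈ ⁅ w ⁆ ∪ B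
  ∈-insert⁺ˡ {w} {B} = p⊆p∪q B (x∈⁅x⁆ w)

  ∈-insert⁺ʳ : ∀ {w u} {B : Subset (n G)} → u ∈ B → u ∈ ⁅ w ⁆ ∪ B
  ∈-insert⁺ʳ {w} {B = B} = q⊆p∪q ⁅ w ⁆ B

  record Compatible (B : Subset (n G)) (c : V → Bool) (w : V) (b : Bool) : Set where
    constructor compatible
    field adj≡side : ∀ {u} → u ∈ B → A w u ≡ b xor c u
  open Compatible public

  compatible? : ∀ B c w b → Dec (Compatible B c w b)
  compatible? B c w b = map′ (λ h → compatible λ {u} → h u) (λ h u → adj≡side h)
    (all? λ u → (u ∈? B) →-dec (A w u ≟ᴮ (b xor c u)))

  Compatible-self : ∀ {B} x → Compatible B (A x) x (A x x)
  Compatible-self x = compatible λ {u} _ → sym (cong (_xor A x u) (irrefl G x))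

  Compatible-⁅⁆ : ∀ {c w u b} → A w u ≡ b xor c u → Compatible ⁅ u ⁆ c w b
  Compatible-⁅⁆ {c} {w} {u} {b} w~u =
    compatible λ v∈ → subst (λ v → A w v ≡ b xor c v) (sym (x∈⁅y⁆⇒x≡y u v∈)) w~u

  Compatible-insert : ∀ {B c w u b} → A w u ≡ b xor c u → Compatible B c w b → Compatible (⁅ u ⁆ ∪ B) c w b
  Compatible-insert {B} {c} {w} {u} {b} w~u compat = compatible λ v∈ → helper (∈-insert⁻ u B v∈)
    where
    helper : ∀ {v} → v ≡ u ⊎ v ∈ B → A w v ≡ b xor c v
    helper (inj₁ refl) = w~u
    helper (inj₂ v∈B)  = adj≡side compat v∈B

  Bipartition-⁅⁆ : ∀ w c → Bipartition ⁅ w ⁆ c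
  Bipartition-⁅⁆ w c = bipartition λ u∈ v∈ → helper (x∈⁅y⁆⇒x≡y w u∈) (x∈⁅y⁆⇒x≡y w v∈)
    where
    helper : ∀ {u v} → u ≡ w → v ≡ w → A u v ≡ c u xor c v
    helper refl refl = trans (irrefl G w) (sym (xor-same (c w)))

  Bipartition-insert : ∀ {B c w} → Bipartition B c → Compatible B c w (c w) → Bipartition (⁅ w ⁆ ∪ B) c
  Bipartition-insert {B} {c} {w} split compat =
    bipartition λ u∈ v∈ → helper (∈-insert⁻ w B u∈) (∈-insert⁻ w B v∈)
    where
    helper : ∀ {u v} → u ≡ w ⊎ u ∈ B → v ≡ w ⊎ v ∈ B → A u v ≡ c u xor c v
    helper (inj₁ refl) (inj₁ refl) = adj≡xor (Bipartition-⁅⁆ w c) (x∈⁅x⁆ w) (x∈⁅x⁆ w)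
    helper (inj₁ refl) (inj₂ v∈B)  = adj≡side compat v∈B
    helper {u} (inj₂ u∈B) (inj₁ refl) =
      trans (Graph.sym G u w) (trans (adj≡side compat u∈B) (xor-comm (c w) (c u)))
    helper (inj₂ u∈B)  (inj₂ v∈B)  = adj≡xor split u∈B v∈B

  recolour : Subset (n G) → (V → Bool) → Bool → V → Bool
  recolour B c b u with u ∈? B
  ... | yes _ = c u
  ... | no  _ = b

  recolour-∈ : ∀ {B c b u} → u ∈ B → recolour B c b u ≡ c u
  recolour-∈ {B} {u = u} u∈B with u ∈? B
  ... | yes _   = refl
  ... | no  u∉B = ⊥-elim (u∉B u∈B)

  recolour-∉ : ∀ {B c b u} → u ∉ B → recolour B c b u ≡ b
  recolour-∉ {B} {u = u} u∉B with u ∈? B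
  ... | yes u∈B = ⊥-elim (u∉B u∈B)
  ... | no  _   = refl

  extend : ∀ {B c w b} → Bipartition B c → w ∉ B → Compatible B c w b → CompleteBipartite (⁅ w ⁆ ∪ B)
  extend {B} {c} {w} {b} split w∉B compat = recolour B c b , Bipartition-insert split' compat'
    where
    split' : Bipartition B (recolour B c b)
    split' = bipartition λ u∈B v∈B →
      trans (adj≡xor split u∈B v∈B) (sym (cong₂ _xor_ (recolour-∈ u∈B) (recolour-∈ v∈B)))
    compat' : Compatible B (recolour B c b) w (recolour B c b w)
    compat' = compatible λ u∈B →
      trans (adj≡side compat u∈B) (sym (cong₂ _xor_ (recolour-∉ w∉B) (recolour-∈ u∈B)))

  -- Two bipartitions of B differ by a constant on B, which fixes the side of w.
  extendable : ∀ {B c w} → Bipartition B c → CompleteBipartite (⁅ w ⁆ ∪ B) → ∃ (Compatible B c w)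
  extendable {B} {c} {w} split (d , split') with any? (_∈? B)
  ... | no  B-empty     = true , compatible λ {u} u∈B → ⊥-elim (B-empty (u , u∈B))
  ... | yes (u₀ , u₀∈B) = d w xor δ , compatible compat
    where
    δ : Bool
    δ = d u₀ xor c u₀
    offset : ∀ {u} → u ∈ B → d u xor c u ≡ δ
    offset {u} u∈B = xor-interchange (d u) (d u₀) (c u) (c u₀)
      (trans (sym (adj≡xor split' (∈-insert⁺ʳ u∈B) (∈-insert⁺ʳ u₀∈B))) (adj≡xor split u∈B u₀∈B))
    cancel : d w xor (d w xor δ) ≡ δ
    cancel = trans (sym (xor-assoc (d w) (d w) δ)) (cong (_xor δ) (xor-same (d w)))
    compat : ∀ {u} → u ∈ B → A w u ≡ (d w xor δ) xor c u
    compat {u} u∈B = trans (adj≡xor split' ∈-insert⁺ˡ (∈-insert⁺ʳ u∈B))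
      (xor-interchange (d w) (d w xor δ) (d u) (c u) (trans cancel (sym (offset u∈B))))

  compatible-side? : ∀ B c w → Dec (∃ (Compatible B c w))
  compatible-side? B c w with compatible? B c w true | compatible? B c w false
  ... | yes t | _     = yes (true , t)
  ... | no _  | yes f = yes (false , f)
  ... | no ¬t | no ¬f = no λ { (true , t) → ¬t t ; (false , f) → ¬f f }

  Rejected : Subset (n G) → V → Set
  Rejected Bs w = ∃[ B ] B ⊆ Bs × ¬ CompleteBipartite (⁅ w ⁆ ∪ B)

  Saturates : List V → Subset (n G) → Subset (n G) → Set
  Saturates ws B Bs = CompleteBipartite Bs × B ⊆ Bs × (∀ w → w ∈ˡ ws → w ∈ Bs ⊎ Rejected Bs w)

  saturate-∷ : ∀ {ws B B'} w → B ⊆ B' → ∃ (Saturates ws B') →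
    (∀ {Bs} → B' ⊆ Bs → w ∈ Bs ⊎ Rejected Bs w) → ∃ (Saturates (w ∷ ws) B)
  saturate-∷ w B⊆B' (Bs , cb , B'⊆Bs , done) settle =
    Bs , cb , B'⊆Bs ∘ B⊆B' , λ { _ (here refl) → settle B'⊆Bs ; v (there v∈ws) → done v v∈ws }

  saturate : ∀ ws B → CompleteBipartite B → ∃ (Saturates ws B)
  saturate [] B cb = B , cb , id , λ _ ()
  saturate (w ∷ ws) B (c , split) with w ∈? B | compatible-side? B c w
  ... | yes w∈B | _ =
    saturate-∷ w id (saturate ws B (c , split)) λ B⊆Bs → inj₁ (B⊆Bs w∈B)
  ... | no w∉B | yes (_ , compat) =
    saturate-∷ w ∈-insert⁺ʳ (saturate ws (⁅ w ⁆ ∪ B) (extend split w∉B compat))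
      λ B'⊆Bs → inj₁ (B'⊆Bs ∈-insert⁺ˡ)
  ... | no _ | no incompatible =
    saturate-∷ w id (saturate ws B (c , split)) λ B⊆Bs → inj₂ (B , B⊆Bs , incompatible ∘ extendable split)

  biclique-containing : ∀ {B} → CompleteBipartite B → ∃[ Bs ] IsBiclique G Bs × B ⊆ Bs
  biclique-containing {B} cb with saturate (allFin (n G)) B cb
  ... | Bs , cbs , B⊆Bs , done = Bs , (CompleteBipartite⇒IsCompleteBipartite cbs , maximal) , B⊆Bs
    where
    maximal : ∀ B' → Bs ⊆ B' → IsCompleteBipartite G B' → B' ⊆ Bs
    maximal B' Bs⊆B' cb' {w} w∈B' with done w (∈-allFin w)
    ... | inj₁ w∈Bs = w∈Bs
    ... | inj₂ (Bw , Bw⊆Bs , ¬cb) =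
      ⊥-elim (¬cb (CompleteBipartite-⊆ insert⊆B' (IsCompleteBipartite⇒CompleteBipartite cb')))
      where
      insert⊆B' : ⁅ w ⁆ ∪ Bw ⊆ B'
      insert⊆B' u∈ with ∈-insert⁻ w Bw u∈
      ... | inj₁ refl = w∈B'
      ... | inj₂ u∈Bw = Bs⊆B' (Bw⊆Bs u∈Bw)

  -- Adjacency in L_G

  EdgeIn-⊆ : ∀ {B B' : Subset (n G)} e → B ⊆ B' → EdgeIn G e B → EdgeIn G e B'
  EdgeIn-⊆ _ B⊆B' (u∈B , v∈B) = B⊆B' u∈B , B⊆B' v∈B

  EdgeIn-∈ₑ : ∀ {B e x} → EdgeIn G e B → x ∈ₑ e → x ∈ B
  EdgeIn-∈ₑ (u∈B , _) lo = u∈B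
  EdgeIn-∈ₑ (_ , v∈B) hi = v∈B

  joins⇒EdgeIn : ∀ {B e x y} → Joins e x y → x ∈ B → y ∈ B → EdgeIn G e B
  joins⇒EdgeIn (lo , hi , _) x∈B y∈B = x∈B , y∈B
  joins⇒EdgeIn (hi , lo , _) x∈B y∈B = y∈B , x∈B
  joins⇒EdgeIn (lo , lo , x≢x) _ _ = ⊥-elim (x≢x refl)
  joins⇒EdgeIn (hi , hi , x≢x) _ _ = ⊥-elim (x≢x refl)

  LAdj-intro : ∀ {e f B} → e ≢ f → CompleteBipartite B → EdgeIn G e B → EdgeIn G f B → LAdj G e f
  LAdj-intro {e} {f} e≢f cb e⊆B f⊆B with biclique-containing cb
  ... | Bs , biclique , B⊆Bs = e≢f , Bs , biclique , EdgeIn-⊆ e B⊆Bs e⊆B , EdgeIn-⊆ f B⊆Bs f⊆B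

  LAdj⇒bipartition : ∀ {e f} → LAdj G e f →
    ∃[ B ] ∃[ c ] Bipartition B c × EdgeIn G e B × EdgeIn G f B
  LAdj⇒bipartition (_ , B , (cb , _) , e⊆B , f⊆B) with IsCompleteBipartite⇒CompleteBipartite cb
  ... | c , split = B , c , split , e⊆B , f⊆B

  cherry⇒LAdj : ∀ {e f x v w} → Joins e x v → Joins f x w → v ≢ w → A v w ≡ false → LAdj G e f
  cherry⇒LAdj {e} {f} {x} {v} {w} x—v x—w v≢w v≁w =
    LAdj-intro e≢f (A x , split) (joins⇒EdgeIn x—v ∈-insert⁺ˡ (∈-insert⁺ʳ ∈-insert⁺ˡ))
                                 (joins⇒EdgeIn x—w ∈-insert⁺ˡ (∈-insert⁺ʳ (∈-insert⁺ʳ (x∈⁅x⁆ w))))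
    where
    compat-v : Compatible ⁅ w ⁆ (A x) v (A x v)
    compat-v = Compatible-⁅⁆ (trans v≁w (sym (cong₂ _xor_ (joins⇒adjacent x—v) (joins⇒adjacent x—w))))
    split : Bipartition (⁅ x ⁆ ∪ ⁅ v ⁆ ∪ ⁅ w ⁆) (A x)
    split = Bipartition-insert (Bipartition-insert (Bipartition-⁅⁆ w (A x)) compat-v) (Compatible-self x)
    e≢f : e ≢ f
    e≢f = ∉-ends⇒≢ x—v (end₂ x—w) (≢-sym (ends-distinct x—w)) (≢-sym v≢w)

  square⇒LAdj : ∀ {e f p q r s} → Joins e p q → Joins f r s → q ≢ r → Matched A p q r s → LAdj G e f
  square⇒LAdj {e} {f} {p} {q} {r} {s} p—q r—s q≢r (p~r , q~s , p≁s , q≁r) =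
    LAdj-intro e≢f (A p , split)
      (joins⇒EdgeIn p—q ∈-insert⁺ˡ (∈-insert⁺ʳ ∈-insert⁺ˡ))
      (joins⇒EdgeIn r—s (∈-insert⁺ʳ (∈-insert⁺ʳ ∈-insert⁺ˡ))
                         (∈-insert⁺ʳ (∈-insert⁺ʳ (∈-insert⁺ʳ (x∈⁅x⁆ s)))))
    where
    p~q : A p q ≡ true
    p~q = joins⇒adjacent p—q
    compat-r : Compatible ⁅ s ⁆ (A p) r (A p r)
    compat-r = Compatible-⁅⁆ (trans (joins⇒adjacent r—s) (sym (cong₂ _xor_ p~r p≁s)))
    compat-q : Compatible (⁅ r ⁆ ∪ ⁅ s ⁆) (A p) q (A p q)
    compat-q = Compatible-insert (trans q≁r (sym (cong₂ _xor_ p~q p~r)))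
                 (Compatible-⁅⁆ (trans q~s (sym (cong₂ _xor_ p~q p≁s))))
    split : Bipartition (⁅ p ⁆ ∪ ⁅ q ⁆ ∪ ⁅ r ⁆ ∪ ⁅ s ⁆) (A p)
    split = Bipartition-insert (Bipartition-insert (Bipartition-insert (Bipartition-⁅⁆ s (A p)) compat-r) compat-q)
              (Compatible-self p)
    e≢f : e ≢ f
    e≢f = ∉-ends⇒≢ p—q (end₁ r—s) (≢-sym (adjacent⇒≢ p~r)) (≢-sym q≢r)

  triangle⇒¬LAdj : ∀ {e f x v w} → Joins e x v → Joins f x w → A v w ≡ true → ¬ LAdj G e f
  triangle⇒¬LAdj x—v x—w v~w L with LAdj⇒bipartition L
  ... | _ , _ , split , e⊆B , f⊆B =
    Bipartition-triangle split
      (EdgeIn-∈ₑ e⊆B (end₁ x—v)) (EdgeIn-∈ₑ e⊆B (end₂ x—v)) (EdgeIn-∈ₑ f⊆B (end₂ x—w))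
      (joins⇒adjacent x—v) (joins⇒adjacent x—w) v~w

  LAdj⇒matched : ∀ {e f p q r s} → LAdj G e f → Joins e p q → Joins f r s →
    Matched A p q r s ⊎ Matched A p q s r
  LAdj⇒matched L p—q r—s with LAdj⇒bipartition L
  ... | _ , _ , split , e⊆B , f⊆B =
    Bipartition-matched split (EdgeIn-∈ₑ e⊆B (end₁ p—q)) (EdgeIn-∈ₑ e⊆B (end₂ p—q))
      (EdgeIn-∈ₑ f⊆B (end₁ r—s)) (EdgeIn-∈ₑ f⊆B (end₂ r—s))
      (joins⇒adjacent p—q) (joins⇒adjacent r—s)

  Clique₄ : E → E → E → E → Set
  Clique₄ e f k l = LAdj G e f × LAdj G k l × LAdj G e k × LAdj G e l × LAdj G f k × LAdj G f l

  Independent₃ : E → E → E → Set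
  Independent₃ e f k = e ≢ f × e ≢ k × f ≢ k × ¬ LAdj G e f × ¬ LAdj G e k × ¬ LAdj G f k

  -- e = pq and f = rs together with k = pr and l = qs form a K₄ of L_G.
  matched⇒clique : ∀ {e f p q r s} → LAdj G e f → Joins e p q → Joins f r s → ¬ Meet e f →
    Matched A p q r s → ∃₂ (Clique₄ e f)
  matched⇒clique {p = p} {q} {r} {s} L p—q r—s apart (p~r , q~s , p≁s , q≁r)
    with edge-joining p~r | edge-joining q~s
  ... | k , p—r | l , q—s =
    k , l , L ,
    square⇒LAdj p—r q—s r≢q (joins⇒adjacent p—q , joins⇒adjacent r—s , p≁s , r≁q) ,
    cherry⇒LAdj p—q p—r (≢-sym r≢q) q≁r ,
    cherry⇒LAdj (joins-sym p—q) q—s p≢s p≁s ,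
    cherry⇒LAdj r—s (joins-sym p—r) (≢-sym p≢s) (trans (Graph.sym G s p) p≁s) ,
    cherry⇒LAdj (joins-sym r—s) (joins-sym q—s) r≢q r≁q
    where
    p≢s : p ≢ s
    p≢s = apart⇒≢ apart (end₁ p—q) (end₂ r—s)
    r≢q : r ≢ q
    r≢q = ≢-sym (apart⇒≢ apart (end₂ p—q) (end₁ r—s))
    r≁q : A r q ≡ false
    r≁q = trans (Graph.sym G r q) q≁r

  LAdj-apart⇒clique : ∀ {e f} → LAdj G e f → ¬ Meet e f → ∃₂ (Clique₄ e f)
  LAdj-apart⇒clique {_ , _ , u<v , u~v} {_ , _ , u'<v' , u'~v'} L apart
    with LAdj⇒matched L (joins-ends u<v u~v) (joins-ends u'<v' u'~v')
  ... | inj₁ m = matched⇒clique L (joins-ends u<v u~v) (joins-ends u'<v' u'~v') apart m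
  ... | inj₂ m = matched⇒clique L (joins-ends u<v u~v) (joins-sym (joins-ends u'<v' u'~v')) apart m

  LAdj⇒meet : (∀ e f k l → ¬ Clique₄ e f k l) → ∀ {e f} → LAdj G e f → Meet e f
  LAdj⇒meet K₄-free {e} {f} L with meet? e f
  ... | yes meet  = meet
  ... | no  apart = ⊥-elim (K₄-free _ _ _ _ (proj₂ (proj₂ (LAdj-apart⇒clique L apart))))

  ¬LAdj⇒triangle : ∀ {e f x v w} → Joins e x v → Joins f x w → e ≢ f → ¬ LAdj G e f → A v w ≡ true
  ¬LAdj⇒triangle {v = v} {w} x—v x—w e≢f ¬L with A v w in v~w
  ... | true  = refl
  ... | false = ⊥-elim (¬L (cherry⇒LAdj x—v x—w v≢w v~w))
    where
    v≢w : v ≢ w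
    v≢w refl = e≢f (joins-injective x—v x—w)

  ¬LAdj-meet⇒independent : ∀ {e f} → e ≢ f → Meet e f → ¬ LAdj G e f → ∃ (Independent₃ e f)
  ¬LAdj-meet⇒independent e≢f (x , x∈e , x∈f) ¬L with other-end x∈e | other-end x∈f
  ... | v , x—v | w , x—w with edge-joining (¬LAdj⇒triangle x—v x—w e≢f ¬L)
  ... | k , v—w =
    k , e≢f ,
    ∉-ends⇒≢ x—v (end₂ v—w) (≢-sym (ends-distinct x—w)) (≢-sym (ends-distinct v—w)) ,
    ∉-ends⇒≢ x—w (end₁ v—w) (≢-sym (ends-distinct x—v)) (ends-distinct v—w) ,
    ¬L ,
    triangle⇒¬LAdj (joins-sym x—v) v—w (joins⇒adjacent x—w) ,
    triangle⇒¬LAdj (joins-sym x—w) (joins-sym v—w) (joins⇒adjacent x—v)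

  ¬LAdj⇒apart : (∀ e f k → ¬ Independent₃ e f k) → ∀ {e f} → e ≢ f → ¬ LAdj G e f → ¬ Meet e f
  ¬LAdj⇒apart no-triple e≢f ¬L meet = no-triple _ _ _ (proj₂ (¬LAdj-meet⇒independent e≢f meet ¬L))

  no-edge⇒nonadjacent : ∀ {x y} → (∀ k → x ∈ₑ k → y ∈ₑ k → ⊥) → A x y ≡ false
  no-edge⇒nonadjacent {x} {y} no-edge with A x y in x~y
  ... | false = refl
  ... | true with edge-joining x~y
  ... | k , x—y = ⊥-elim (no-edge k (end₁ x—y) (end₂ x—y))

  -- Edges meeting cyclically form the 4-cycle a–c–d–b–a of G, which is complete bipartite.
  four-cycle⇒LAdj : ∀ (e : Fin 4 → E) → (∀ k → ∃[ i ] k ≡ e i) →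
    Meet (e (# 0)) (e (# 1)) → Meet (e (# 1)) (e (# 2)) → Meet (e (# 2)) (e (# 3)) → Meet (e (# 3)) (e (# 0)) →
    ¬ Meet (e (# 0)) (e (# 2)) → ¬ Meet (e (# 1)) (e (# 3)) → LAdj G (e (# 0)) (e (# 2))
  four-cycle⇒LAdj e cover (a , a∈0 , a∈1) (c , c∈1 , c∈2) (d , d∈2 , d∈3) (b , b∈3 , b∈0)
    apart02 apart13 =
    square⇒LAdj (a∈0 , b∈0 , apart⇒≢ apart13 a∈1 b∈3) (c∈2 , d∈2 , apart⇒≢ apart13 c∈1 d∈3)
      (apart⇒≢ apart02 b∈0 c∈2)
      (joins⇒adjacent (a∈1 , c∈1 , apart⇒≢ apart02 a∈0 c∈2) ,
       joins⇒adjacent (b∈3 , d∈3 , apart⇒≢ apart02 b∈0 d∈2) ,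
       no-edge⇒nonadjacent no-ad , no-edge⇒nonadjacent no-bc)
    where
    no-ad : ∀ k → a ∈ₑ k → d ∈ₑ k → ⊥
    no-ad k a∈k d∈k with cover k
    ... | zero , refl                   = apart02 (d , d∈k , d∈2)
    ... | suc zero , refl               = apart13 (d , d∈k , d∈3)
    ... | suc (suc zero) , refl         = apart02 (a , a∈0 , a∈k)
    ... | suc (suc (suc zero)) , refl   = apart13 (a , a∈1 , a∈k)
    no-bc : ∀ k → b ∈ₑ k → c ∈ₑ k → ⊥
    no-bc k b∈k c∈k with cover k
    ... | zero , refl                   = apart02 (c , c∈k , c∈2)
    ... | suc zero , refl               = apart13 (b , b∈k , b∈3)
    ... | suc (suc zero) , refl         = apart02 (b , b∈0 , b∈k)
    ... | suc (suc (suc zero)) , refl   = apart13 (c , c∈1 , c∈k)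

  ends-on-edge⇒¬LAdj : ∀ {e f k x y z} → Joins e x y → Joins f x z → y ∈ₑ k → z ∈ₑ k → ¬ LAdj G e f
  ends-on-edge⇒¬LAdj {y = y} {z} x—y x—z y∈k z∈k L with y ≟ᶠ z
  ... | yes refl = proj₁ L (joins-injective x—y x—z)
  ... | no  y≢z  = triangle⇒¬LAdj x—y x—z (joins⇒adjacent (y∈k , z∈k , y≢z)) L

  diamond⇒¬LAdj : ∀ {e₀ e₁ e₂ e₃} → Meet e₀ e₁ → Meet e₀ e₂ → Meet e₀ e₃ →
    Meet e₁ e₂ → Meet e₁ e₃ → ¬ Meet e₂ e₃ → ¬ LAdj G e₀ e₁
  diamond⇒¬LAdj {e₀} {e₁} (x , x∈0 , x∈1) (y , y∈0 , y∈2) (y' , y'∈0 , y'∈3)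
                            (z , z∈1 , z∈2) (z' , z'∈1 , z'∈3) apart =
    [ (λ x≡y → ends-on-edge⇒¬LAdj y—y'
        (subst (_∈ₑ e₁) x≡y x∈1 , z'∈1 , apart⇒≢ apart y∈2 z'∈3) y'∈3 z'∈3)
    , (λ x≡y' → ends-on-edge⇒¬LAdj (joins-sym y—y')
        (subst (_∈ₑ e₁) x≡y' x∈1 , z∈1 , ≢-sym (apart⇒≢ apart z∈2 y'∈3)) y∈2 z∈2)
    ] (joins-∈ₑ y—y' x∈0)
    where
    y—y' : Joins e₀ y y'
    y—y' = y∈0 , y'∈0 , apart⇒≢ apart y∈2 y'∈3

  dominating⇒LAdj : ∀ {e₀ e₁ e₂ x} → (∀ k → Meet e₀ k) → LAdj G e₀ e₁ → LAdj G e₀ e₂ →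
    x ∈ₑ e₀ → x ∈ₑ e₁ → x ∈ₑ e₂ → e₁ ≢ e₂ → LAdj G e₁ e₂
  dominating⇒LAdj dominating L₀₁ L₀₂ x∈0 x∈1 x∈2 e₁≢e₂ with other-end x∈1 | other-end x∈2
  ... | v , x—v | w , x—w with A v w in v~w
  ... | false = cherry⇒LAdj x—v x—w v≢w v~w
    where
    v≢w : v ≢ w
    v≢w refl = e₁≢e₂ (joins-injective x—v x—w)
  ... | true with edge-joining v~w
  ... | k , v—w with dominating k
  ... | y , y∈0 , y∈k with joins-∈ₑ v—w y∈k
  ... | inj₁ refl = ⊥-elim (proj₁ L₀₁ (joins-injective (x∈0 , y∈0 , ends-distinct x—v) x—v))
  ... | inj₂ refl = ⊥-elim (proj₁ L₀₂ (joins-injective (x∈0 , y∈0 , ends-distinct x—w) x—w))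

K₄-free : ∀ {m} → (Fin m → Fin m → Bool) → Set
K₄-free H = ∀ i j k l →
  ¬ (H i j ≡ true × H k l ≡ true × H i k ≡ true × H i l ≡ true × H j k ≡ true × H j l ≡ true)

k₄-free? : ∀ {m} (H : Fin m → Fin m → Bool) → Dec (K₄-free H)
k₄-free? H = all? λ i → all? λ j → all? λ k → all? λ l → ¬?
  ((H i j ≟ᴮ true) ×-dec (H k l ≟ᴮ true) ×-dec (H i k ≟ᴮ true) ×-dec (H i l ≟ᴮ true) ×-dec
   (H j k ≟ᴮ true) ×-dec (H j l ≟ᴮ true))

NoIndependentTriple : ∀ {m} → (Fin m → Fin m → Bool) → Set
NoIndependentTriple H = ∀ i j k →
  ¬ (i ≢ j × i ≢ k × j ≢ k × H i j ≡ false × H i k ≡ false × H j k ≡ false)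

noIndependentTriple? : ∀ {m} (H : Fin m → Fin m → Bool) → Dec (NoIndependentTriple H)
noIndependentTriple? H = all? λ i → all? λ j → all? λ k → ¬?
  (¬? (i ≟ᶠ j) ×-dec ¬? (i ≟ᶠ k) ×-dec ¬? (j ≟ᶠ k) ×-dec
   (H i j ≟ᴮ false) ×-dec (H i k ≟ᴮ false) ×-dec (H j k ≟ᴮ false))

module LineGraphIsomorphism {G : Graph} {m} {H : Fin m → Fin m → Bool} (L≅H : LineGraphIso G m H) where
  open BicliqueLineGraph G

  φ : E ↔ Fin m
  φ = proj₁ L≅H

  index : E → Fin m
  index = Inverse.to φ

  edge : Fin m → E
  edge = Inverse.from φ

  LAdj⇒H : ∀ {e f} → LAdj G e f → H (index e) (index f) ≡ true
  LAdj⇒H {e} {f} = Equivalence.to (proj₂ L≅H e f)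

  ¬LAdj⇒H : ∀ {e f} → ¬ LAdj G e f → H (index e) (index f) ≡ false
  ¬LAdj⇒H {e} {f} ¬L = ¬-not (¬L ∘ Equivalence.from (proj₂ L≅H e f))

  index-injective : ∀ {e f} → e ≢ f → index e ≢ index f
  index-injective e≢f = e≢f ∘ Injection.injective (↔⇒↣ φ)

  edge-injective : ∀ {i j} → i ≢ j → edge i ≢ edge j
  edge-injective i≢j = i≢j ∘ Injection.injective (↔⇒↣ (↔-sym φ))

  edge-surjective : ∀ e → ∃[ i ] e ≡ edge i
  edge-surjective e = index e , sym (Inverse.strictlyInverseʳ φ e)

  H-index-edge : ∀ i j → H (index (edge i)) (index (edge j)) ≡ H i j
  H-index-edge i j = cong₂ H (Inverse.strictlyInverseˡ φ i) (Inverse.strictlyInverseˡ φ j)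

  H⇒LAdj : ∀ {i j} → H i j ≡ true → LAdj G (edge i) (edge j)
  H⇒LAdj {i} {j} = Equivalence.from (proj₂ L≅H (edge i) (edge j)) ∘ trans (H-index-edge i j)

  ¬H⇒¬LAdj : ∀ {i j} → H i j ≡ false → ¬ LAdj G (edge i) (edge j)
  ¬H⇒¬LAdj {i} {j} ¬Hij = not-¬ ¬Hij ∘ trans (sym (H-index-edge i j)) ∘ LAdj⇒H

  H-meet : K₄-free H → ∀ i j → H i j ≡ true → Meet (edge i) (edge j)
  H-meet H-K₄-free _ _ = LAdj⇒meet K₄-free-L ∘ H⇒LAdj
    where
    K₄-free-L : ∀ e f k l → ¬ Clique₄ e f k l
    K₄-free-L e f k l (Lef , Lkl , Lek , Lel , Lfk , Lfl) =
      H-K₄-free _ _ _ _ (LAdj⇒H Lef , LAdj⇒H Lkl , LAdj⇒H Lek , LAdj⇒H Lel , LAdj⇒H Lfk , LAdj⇒H Lfl)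

  H-apart : NoIndependentTriple H → ∀ i j → i ≢ j → H i j ≡ false → ¬ Meet (edge i) (edge j)
  H-apart H-triple-free _ _ i≢j ¬Hij = ¬LAdj⇒apart triple-free-L (edge-injective i≢j) (¬H⇒¬LAdj ¬Hij)
    where
    triple-free-L : ∀ e f k → ¬ Independent₃ e f k
    triple-free-L e f k (e≢f , e≢k , f≢k , ¬Lef , ¬Lek , ¬Lfk) =
      H-triple-free _ _ _ (index-injective e≢f , index-injective e≢k , index-injective f≢k ,
                           ¬LAdj⇒H ¬Lef , ¬LAdj⇒H ¬Lek , ¬LAdj⇒H ¬Lfk)

c4-not-biclique-line-graph : ∀ G → ¬ LineGraphIso G 4 c4
c4-not-biclique-line-graph G L≅c4 =
  ¬H⇒¬LAdj {# 0} {# 2} refl (four-cycle⇒LAdj edge edge-surjective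
    (meet (# 0) (# 1) refl) (meet (# 1) (# 2) refl) (meet (# 2) (# 3) refl) (meet (# 3) (# 0) refl)
    (apart (# 0) (# 2) (λ ()) refl) (apart (# 1) (# 3) (λ ()) refl))
  where
  open BicliqueLineGraph G
  open LineGraphIsomorphism {H = c4} L≅c4
  meet : ∀ i j → c4 i j ≡ true → Meet (edge i) (edge j)
  meet = H-meet (from-yes (k₄-free? c4))
  apart : ∀ i j → i ≢ j → c4 i j ≡ false → ¬ Meet (edge i) (edge j)
  apart = H-apart (from-yes (noIndependentTriple? c4))

diamond-not-biclique-line-graph : ∀ G → ¬ LineGraphIso G 4 diamond
diamond-not-biclique-line-graph G L≅diamond =
  diamond⇒¬LAdj (meet (# 0) (# 1) refl) (meet (# 0) (# 2) refl) (meet (# 0) (# 3) refl)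
    (meet (# 1) (# 2) refl) (meet (# 1) (# 3) refl) (apart (# 2) (# 3) (λ ()) refl)
    (H⇒LAdj {# 0} {# 1} refl)
  where
  open BicliqueLineGraph G
  open LineGraphIsomorphism {H = diamond} L≅diamond
  meet : ∀ i j → diamond i j ≡ true → Meet (edge i) (edge j)
  meet = H-meet (from-yes (k₄-free? diamond))
  apart : ∀ i j → i ≢ j → diamond i j ≡ false → ¬ Meet (edge i) (edge j)
  apart = H-apart (from-yes (noIndependentTriple? diamond))

claw-not-biclique-line-graph : ∀ G → ¬ LineGraphIso G 4 claw
claw-not-biclique-line-graph G L≅claw =
  pigeonhole (meet (# 0) (# 1) refl) (meet (# 0) (# 2) refl) (meet (# 0) (# 3) refl)
  where
  open BicliqueLineGraph G
  open LineGraphIsomorphism {H = claw} L≅claw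
  meet : ∀ i j → claw i j ≡ true → Meet (edge i) (edge j)
  meet = H-meet (from-yes (k₄-free? claw))
  dominating : ∀ k → Meet (edge (# 0)) k
  dominating k with edge-surjective k
  ... | zero  , refl = meet-refl _
  ... | suc i , refl = meet (# 0) (suc i) refl
  spoke : ∀ i j → claw (# 0) i ≡ true → claw (# 0) j ≡ true →
    ∀ {x} → x ∈ₑ edge (# 0) → x ∈ₑ edge i → x ∈ₑ edge j → i ≢ j → claw i j ≡ false → ⊥
  spoke i j 0~i 0~j x∈0 x∈i x∈j i≢j i≁j =
    ¬H⇒¬LAdj i≁j (dominating⇒LAdj dominating (H⇒LAdj 0~i) (H⇒LAdj 0~j) x∈0 x∈i x∈j (edge-injective i≢j))
  pigeonhole : Meet (edge (# 0)) (edge (# 1)) → Meet (edge (# 0)) (edge (# 2)) → Meet (edge (# 0)) (edge (# 3)) → ⊥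
  pigeonhole (x₁ , x₁∈0 , x₁∈1) (x₂ , x₂∈0 , x₂∈2) (x₃ , x₃∈0 , x₃∈3) with x₂ ≟ᶠ x₁
  ... | yes refl = spoke (# 1) (# 2) refl refl x₁∈0 x₁∈1 x₂∈2 (λ ()) refl
  ... | no x₂≢x₁ with joins-∈ₑ (x₁∈0 , x₂∈0 , ≢-sym x₂≢x₁) x₃∈0
  ...   | inj₁ refl = spoke (# 1) (# 3) refl refl x₁∈0 x₁∈1 x₃∈3 (λ ()) refl
  ...   | inj₂ refl = spoke (# 2) (# 3) refl refl x₂∈0 x₂∈2 x₃∈3 (λ ()) refl

proposition17 : (G : Graph) →
    (¬ LineGraphIso G 4 c4) × (¬ LineGraphIso G 4 diamond) × (¬ LineGraphIso G 4 claw)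
proposition17 G =
  c4-not-biclique-line-graph G , diamond-not-biclique-line-graph G , claw-not-biclique-line-graph G
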